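{- Let $\mathcal{A} = (\mathbb{N}, S^{\mathcal{A}})$ be a structure with domain $\mathbb{N}$ that is isomorphic to $\mathcal{S} = (\mathbb{N}, S)$. Then $\mathcal{A}$ is punctually isomorphic to $\mathcal{S}$ if and only if $\mathcal{A}$ is punctually standard.
   Context: $S$ denotes the successor function on $\mathbb{N}$. For a copy $\mathcal{A} = (\mathbb{N}, S^{\mathcal{A}})$ of $\mathcal{S} = (\mathbb{N}, S)$, let $c_{\mathcal{A}} : (\mathbb{N}, S) \to \mathcal{A}$ be the (unique) isomorphism. For a function $f:\mathbb{N}^k\to\mathbb{N}$, its representation in $\mathcal{A}$ is $f^{\mathcal{A}}(x_1,\dots,x_k) = c_{\mathcal{A}}(f(c_{\mathcal{A}}^{ -1}(x_1),\dots,c_{\mathcal{A}}^{ -1}(x_k)))$; $f$ is primitive recursive on $\mathcal{A}$ if $f^{\mathcal{A}}$ is primitive recursive. Let $\mathcal{PR}$ be the class of primitive recursive functions and $\mathcal{PR}^{\mathcal{A}}$ the class of functions primitive recursive on $\mathcal{A}$. $\mathcal{A}$ is punctually standard if $\mathcal{PR} = \mathcal{PR}^{\mathcal{A}}$. Two structures with domain $\mathbb{N}$ are punctually isomorphic if there is an isomorphism $f$ between them such that both $f$ and $f^{ -1}$ are primitive recursive. -}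

module Defs where

open import Data.Nat using (ℕ; zero; suc)
open import Data.Fin using (Fin)
open import Data.Vec using (Vec; []; _∷_; lookup; map)
open import Data.Product using (Σ; _×_; _,_)
open import Relation.Binary.PropositionalEquality using (_≡_)
open import Function.Bundles using (_⇔_)

data PRTerm : ℕ → Set where
  zeroF : ∀ {k} → PRTerm k
  succF : PRTerm 1
  projF : ∀ {k} → Fin k → PRTerm k
  compF : ∀ {k m} → PRTerm m → Vec (PRTerm k) m → PRTerm k
  recF  : ∀ {k} → PRTerm k → PRTerm (suc (suc k)) → PRTerm (suc k)

mutual
  eval : ∀ {k} → PRTerm k → Vec ℕ k → ℕ
  eval zeroF        xs       = 0
  eval succF        (x ∷ []) = suc x
  eval (projF i)    xs       = lookup xs i
  eval (compF f gs) xs       = eval f (evalAll gs xs)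
  eval (recF g s)   (n ∷ xs) = evalRec g s n xs

  evalAll : ∀ {k m} → Vec (PRTerm k) m → Vec ℕ k → Vec ℕ m
  evalAll []       xs = []
  evalAll (g ∷ gs) xs = eval g xs ∷ evalAll gs xs

  evalRec : ∀ {k} → PRTerm k → PRTerm (suc (suc k)) → ℕ → Vec ℕ k → ℕ
  evalRec g s zero    xs = eval g xs
  evalRec g s (suc n) xs = eval s (n ∷ evalRec g s n xs ∷ xs)

IsPR : ∀ {k} → (Vec ℕ k → ℕ) → Set
IsPR {k} f = Σ (PRTerm k) λ t → ∀ xs → eval t xs ≡ f xs

IsPR₁ : (ℕ → ℕ) → Set
IsPR₁ f = IsPR {1} λ { (x ∷ []) → f x }

-- A structure with domain ℕ and one unary function: given by that function.
-- An isomorphism from (ℕ, S) onto (ℕ, SA): a bijection c (with inverse d)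
-- commuting with successor.
record IsoFromS (SA : ℕ → ℕ) : Set where
  field
    c     : ℕ → ℕ
    d     : ℕ → ℕ
    c∘d   : ∀ x → c (d x) ≡ x
    d∘c   : ∀ n → d (c n) ≡ n
    c-hom : ∀ n → c (suc n) ≡ SA (c n)

repr : ∀ {SA} → IsoFromS SA → ∀ {k} → (Vec ℕ k → ℕ) → (Vec ℕ k → ℕ)
repr iso f xs = c (f (map d xs)) where open IsoFromS iso

-- A is punctually standard: PR = PR^A (as classes of functions of every arity).
PunctuallyStandard : ∀ {SA} → IsoFromS SA → Set
PunctuallyStandard iso = ∀ {k} (f : Vec ℕ k → ℕ) → IsPR f ⇔ IsPR (repr iso f)

PunctuallyIsoToS : (ℕ → ℕ) → Set
PunctuallyIsoToS SA =
  Σ (ℕ → ℕ) λ g → Σ (ℕ → ℕ) λ h →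
    (∀ x → h (g x) ≡ x) × (∀ n → g (h n) ≡ n) ×
    (∀ x → g (SA x) ≡ suc (g x)) × IsPR₁ g × IsPR₁ h

{-# OPTIONS --safe #-}
module Submission where

-- Both conditions say that the canonical isomorphism c : (ℕ, S) → A and its
-- inverse d are primitive recursive.  For punctual isomorphism this is rigidity:
-- (ℕ, S) has no nontrivial automorphisms, so every isomorphism A → S is d.
-- For punctual standardness, representations in A are conjugation by c, and
-- conversely c iterates S^A = suc^A while d iterates the function whose
-- representation in A is suc.

open import Defs
open import Data.Nat using (ℕ; zero; suc; _+_)
open import Data.Nat.Properties using (+-identityʳ; m+n≡0⇒n≡0)
open import Data.Fin using (Fin) renaming (zero to fzero; suc to fsuc)
open import Data.Vec using (Vec; []; _∷_; lookup; map; tabulate)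
open import Data.Vec.Properties using (map-cong; map-∘; map-id; tabulate-cong; tabulate-∘; tabulate∘lookup)
open import Data.Product using (_×_; _,_)
open import Function.Base using (_∘_)
open import Function.Bundles using (_⇔_; mk⇔; Equivalence)
import Function.Properties.Equivalence as ⇔
open import Relation.Binary.PropositionalEquality
open ≡-Reasoning

IsPR-resp : ∀ {k} {f g : Vec ℕ k → ℕ} → (∀ xs → f xs ≡ g xs) → IsPR f → IsPR g
IsPR-resp f≗g (t , t≗f) = t , λ xs → trans (t≗f xs) (f≗g xs)

constF : ∀ {k} → ℕ → PRTerm k
constF zero    = zeroF
constF (suc n) = compF succF (constF n ∷ [])

eval-constF : ∀ {k} n (xs : Vec ℕ k) → eval (constF n) xs ≡ n
eval-constF zero    xs = refl
eval-constF (suc n) xs = cong suc (eval-constF n xs)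

evalAll-tabulate : ∀ {k m} (ts : Fin m → PRTerm k) (xs : Vec ℕ k) →
  evalAll (tabulate ts) xs ≡ tabulate (λ j → eval (ts j) xs)
evalAll-tabulate {m = zero}  ts xs = refl
evalAll-tabulate {m = suc m} ts xs = cong (eval (ts fzero) xs ∷_) (evalAll-tabulate (ts ∘ fsuc) xs)

IsPR₁-iteration : ∀ {f : ℕ → ℕ} → IsPR₁ f →
  (r : ℕ → ℕ) → (∀ n → r (suc n) ≡ f (r n)) → IsPR₁ r
IsPR₁-iteration {f} (t , t≗f) r r-step =
  recF (constF (r 0)) step , λ { (n ∷ []) → evalRec-step n }
  where
  step : PRTerm 2
  step = compF t (projF (fsuc fzero) ∷ [])
  evalRec-step : ∀ n → evalRec (constF (r 0)) step n [] ≡ r n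
  evalRec-step zero    = eval-constF (r 0) []
  evalRec-step (suc n) = begin
    eval t (evalRec (constF (r 0)) step n [] ∷ []) ≡⟨ cong (λ y → eval t (y ∷ [])) (evalRec-step n) ⟩
    eval t (r n ∷ [])                              ≡⟨ t≗f (r n ∷ []) ⟩
    f (r n)                                        ≡⟨ sym (r-step n) ⟩
    r (suc n)                                      ∎

IsPR-postcomp : ∀ {k} {u : ℕ → ℕ} {f : Vec ℕ k → ℕ} → IsPR₁ u → IsPR f → IsPR (u ∘ f)
IsPR-postcomp {u = u} (tu , tu≗u) (tf , tf≗f) =
  compF tu (tf ∷ []) , λ xs → trans (tu≗u (eval tf xs ∷ [])) (cong u (tf≗f xs))

IsPR-precomp-map : ∀ {k} {v : ℕ → ℕ} {f : Vec ℕ k → ℕ} → IsPR₁ v → IsPR f → IsPR (f ∘ map v)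
IsPR-precomp-map {k} {v} (tv , tv≗v) (tf , tf≗f) =
  compF tf (tabulate applyV) , λ xs → trans (cong (eval tf) (evalAll-applyV xs)) (tf≗f (map v xs))
  where
  applyV : Fin k → PRTerm k
  applyV j = compF tv (projF j ∷ [])
  evalAll-applyV : ∀ xs → evalAll (tabulate applyV) xs ≡ map v xs
  evalAll-applyV xs = begin
    evalAll (tabulate applyV) xs             ≡⟨ evalAll-tabulate applyV xs ⟩
    tabulate (λ j → eval tv (lookup xs j ∷ [])) ≡⟨ tabulate-cong (λ j → tv≗v (lookup xs j ∷ [])) ⟩
    tabulate (v ∘ lookup xs)                 ≡⟨ tabulate-∘ v (lookup xs) ⟩
    map v (tabulate (lookup xs))             ≡⟨ cong (map v) (tabulate∘lookup xs) ⟩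
    map v xs                                 ∎

IsPR-conj : ∀ {k} {u v : ℕ → ℕ} {f : Vec ℕ k → ℕ} → IsPR₁ u → IsPR₁ v → IsPR f →
  IsPR (λ xs → u (f (map v xs)))
IsPR-conj uP vP fP = IsPR-postcomp uP (IsPR-precomp-map vP fP)

suc-hom-hitting-0⇒≗id : ∀ (e : ℕ → ℕ) {z} → (∀ n → e (suc n) ≡ suc (e n)) → e z ≡ 0 →
  ∀ n → e n ≡ n
suc-hom-hitting-0⇒≗id e {z} e-hom ez≡0 n = begin
  e n     ≡⟨ e≡+e0 n ⟩
  n + e 0 ≡⟨ cong (n +_) (m+n≡0⇒n≡0 z (trans (sym (e≡+e0 z)) ez≡0)) ⟩
  n + 0   ≡⟨ +-identityʳ n ⟩
  n       ∎
  where
  e≡+e0 : ∀ n → e n ≡ n + e 0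
  e≡+e0 zero    = refl
  e≡+e0 (suc n) = trans (e-hom n) (cong suc (e≡+e0 n))

module _ {SA : ℕ → ℕ} (iso : IsoFromS SA) where
  open IsoFromS iso

  IsPunctualIso : Set
  IsPunctualIso = IsPR₁ c × IsPR₁ d

  d-hom : ∀ x → d (SA x) ≡ suc (d x)
  d-hom x = begin
    d (SA x)           ≡⟨ cong (d ∘ SA) (sym (c∘d x)) ⟩
    d (SA (c (d x)))   ≡⟨ cong d (sym (c-hom (d x))) ⟩
    d (c (suc (d x)))  ≡⟨ d∘c (suc (d x)) ⟩
    suc (d x)          ∎

  punctuallyIsoToS⇒isPunctualIso : PunctuallyIsoToS SA → IsPunctualIso
  punctuallyIsoToS⇒isPunctualIso (g , h , h∘g , g∘h , g-hom , gP , hP) =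
    IsPR-resp (λ { (x ∷ []) → h≗c x }) hP , IsPR-resp (λ { (x ∷ []) → g≗d x }) gP
    where
    g∘c≗id : ∀ n → g (c n) ≡ n
    g∘c≗id = suc-hom-hitting-0⇒≗id (g ∘ c)
      (λ n → trans (cong g (c-hom n)) (g-hom (c n)))
      (trans (cong g (c∘d (h 0))) (g∘h 0))
    g≗d : ∀ x → g x ≡ d x
    g≗d x = trans (cong g (sym (c∘d x))) (g∘c≗id (d x))
    h≗c : ∀ x → h x ≡ c x
    h≗c x = trans (cong h (sym (g∘c≗id x))) (h∘g (c x))

  isPunctualIso⇒punctuallyIsoToS : IsPunctualIso → PunctuallyIsoToS SA
  isPunctualIso⇒punctuallyIsoToS (cP , dP) = d , c , c∘d , d∘c , d-hom , dP , cP

  isPunctualIso⇒punctuallyStandard : IsPunctualIso → PunctuallyStandard iso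
  isPunctualIso⇒punctuallyStandard (cP , dP) f =
    mk⇔ (IsPR-conj cP dP) (IsPR-resp unconjugate ∘ IsPR-conj dP cP)
    where
    unconjugate : ∀ xs → d (repr iso f (map c xs)) ≡ f xs
    unconjugate xs = begin
      d (c (f (map d (map c xs)))) ≡⟨ d∘c _ ⟩
      f (map d (map c xs))         ≡⟨ cong f (sym (map-∘ d c xs)) ⟩
      f (map (d ∘ c) xs)           ≡⟨ cong f (trans (map-cong d∘c xs) (map-id xs)) ⟩
      f xs                         ∎

  punctuallyStandard⇒isPunctualIso : PunctuallyStandard iso → IsPunctualIso
  punctuallyStandard⇒isPunctualIso standard =
    IsPR₁-iteration SA-isPR c c-hom , IsPR₁-iteration sucᴬ⁻¹-isPR d d-step
    where
    sucV : Vec ℕ 1 → ℕ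
    sucV (x ∷ []) = suc x
    sucV-isPR : IsPR sucV
    sucV-isPR = succF , λ { (x ∷ []) → refl }
    SA-isPR : IsPR₁ SA
    SA-isPR = IsPR-resp (λ { (x ∷ []) → trans (c-hom (d x)) (cong SA (c∘d x)) })
                        (Equivalence.to (standard sucV) sucV-isPR)
    -- the function whose representation in A is suc
    sucᴬ⁻¹-isPR : IsPR₁ (λ x → d (suc (c x)))
    sucᴬ⁻¹-isPR = Equivalence.from (standard _)
      (IsPR-resp (λ { (x ∷ []) → sym (trans (c∘d _) (cong suc (c∘d x))) }) sucV-isPR)
    d-step : ∀ n → d (suc n) ≡ d (suc (c (d n)))
    d-step n = cong (d ∘ suc) (sym (c∘d n))

mainTheorem1 : (SA : ℕ → ℕ) (iso : IsoFromS SA) →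
    PunctuallyIsoToS SA ⇔ PunctuallyStandard iso
mainTheorem1 SA iso =
  ⇔.trans (mk⇔ (punctuallyIsoToS⇒isPunctualIso iso) (isPunctualIso⇒punctuallyIsoToS iso))
          (mk⇔ (isPunctualIso⇒punctuallyStandard iso) (punctuallyStandard⇒isPunctualIso iso))
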